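{- Let $f\colon\{2,4,6\}\to\mathbb{N}$. If $f$ is realizable, then $f(4)=\tfrac12\big(f(2)+f(6)\big)$.
   Context: $\mathrm{dist}$ denotes Hamming distance. For a partial function $f$ from $\mathbb{N}$ to $\mathbb{N}$ with domain $\mathrm{dom}(f)\subseteq\mathbb{N}$, a map $E\colon\{0,1\}^n\to\{0,1\}^m$ is an $f$-code if $\mathrm{dist}(E(x),E(y))=f(\mathrm{dist}(x,y))$ for all $x,y\in\{0,1\}^n$ with $\mathrm{dist}(x,y)\in\mathrm{dom}(f)$. The function $f$ is realizable if there is a function $m\colon\mathbb{N}\to\mathbb{N}$ such that for infinitely many $n$ there exists an $f$-code $\{0,1\}^n\to\{0,1\}^{m(n)}$. -}

module Defs where

open import Data.Nat using (ℕ; _+_; _≤_)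
open import Data.Bool using (Bool; true; false)
open import Data.Vec using (Vec; []; _∷_)
open import Data.Product using (Σ; _×_; ∃-syntax)
open import Data.Sum using (_⊎_)
open import Relation.Binary.PropositionalEquality using (_≡_)

dist : ∀ {n} → Vec Bool n → Vec Bool n → ℕ
dist [] [] = 0
dist (true ∷ xs) (true ∷ ys) = dist xs ys
dist (false ∷ xs) (false ∷ ys) = dist xs ys
dist (true ∷ xs) (false ∷ ys) = 1 + dist xs ys
dist (false ∷ xs) (true ∷ ys) = 1 + dist xs ys

PartialFun : (Dom : ℕ → Set) → Set
PartialFun Dom = (d : ℕ) → Dom d → ℕ

IsCode : {Dom : ℕ → Set} → PartialFun Dom → {n m : ℕ} →
         (Vec Bool n → Vec Bool m) → Set
IsCode {Dom} f {n} {m} E =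
  (x y : Vec Bool n) → (h : Dom (dist x y)) → dist (E x) (E y) ≡ f (dist x y) h

-- f is realizable: some m : ℕ → ℕ such that for infinitely many n
-- (i.e. for every N there is n ≥ N) an f-code {0,1}^n → {0,1}^(m n) exists
Realizable : {Dom : ℕ → Set} → PartialFun Dom → Set
Realizable {Dom} f =
  Σ (ℕ → ℕ) λ m → (N : ℕ) → ∃[ n ] (N ≤ n × Σ (Vec Bool n → Vec Bool (m n)) λ E → IsCode f E)

Dom246 : ℕ → Set
Dom246 d = d ≡ 2 ⊎ (d ≡ 4 ⊎ d ≡ 6)

{-# OPTIONS --safe #-}
-- Let a, b, c be f 2, f 4, f 6 and E an f-code; padding with zeros gives such codes in every
-- dimension. Points at distance 2 from a centre o and pairwise at distance 4 (a star) are sent to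
-- sets E p ⊕ E o of size a with pairwise symmetric differences of size b. Pigeonholing their traces
-- on one of them turns a star with 2^a (a + b + 1) spokes into a sunflower with a + b + 1 members
-- whose kernel G satisfies b + 2 ∣G∣ = 2a, and every set of size at most a + b meets some member
-- only inside G. Take stars around O and around V, and a point Y at distance 2 from both: the two
-- kernels lie in E Y ⊕ E O and E Y ⊕ E V respectively, so they are disjoint. A spoke p around O
-- whose set avoids the kernel G of V's star, followed by a spoke r around V, then gives
-- (E p ⊕ E V) ∩ (E r ⊕ E V) = G; as d(p, r) = 6 this reads c + 2 ∣G∣ = b + a, hence 2b = a + c.
module Submission where

open import Defs
open import Data.Bool using (Bool; true; false; _∧_; _xor_; not)
open import Data.Bool.Properties using (xor-same)
import Data.Bool as Bool
open import Data.Fin using (Fin)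
open import Data.Fin.Subset using (Subset; _∈_; _∉_; _⊆_; _∩_; _─_; ∣_∣; Empty)
open import Data.Fin.Subset.Properties
  using (_∈?_; nonempty?; x∈p∩q⁺; x∈p∩q⁻; x∈p∧x∉q⇒x∈p─q; p─q⊆p; p∩q⊆p; p∩q⊆q; ⊆-antisym;
         p⊆q⇒∣p∣≤∣q∣; p⊂q⇒∣p∣<∣q∣; p∩q≢∅⇒∣p─q∣<∣p∣)
open import Data.List using (List; []; _∷_; length; map; filter)
open import Data.List.Properties using (length-map)
open import Data.List.Relation.Unary.All as All using (All; []; _∷_)
import Data.List.Relation.Unary.All.Properties as All
open import Data.List.Relation.Unary.AllPairs as AllPairs using (AllPairs; []; _∷_)
import Data.List.Relation.Unary.AllPairs.Properties as AllPairs
open import Data.List.Relation.Unary.Any as Any using (Any; here; there)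
open import Data.List.Relation.Binary.Sublist.Propositional using ([]; _∷_; _∷ʳ_; ⊆-refl; ⊆-trans)
  renaming (_⊆_ to _⊑_)
open import Data.List.Relation.Binary.Sublist.Propositional.Properties using (All-resp-⊆; filter-⊆)
open import Data.Nat using (ℕ; zero; suc; _+_; _*_; _^_; _≤_; _<_; z≤n; s≤s)
open import Data.Nat.Properties
open import Data.Product using (Σ; _×_; _,_; proj₁; proj₂; ∃-syntax; ∃₂)
open import Data.Sum using (_⊎_; inj₁; inj₂)
open import Data.Vec using (Vec; []; _∷_; _++_; replicate; zipWith; lookup; head; tail)
import Data.Vec as Vec
open import Data.Vec.Properties using (lookup-zipWith; []=⇒lookup; lookup⇒[]=)
open import Function using (_∘_)
open import Relation.Nullary using (yes; no; contradiction)
open import Relation.Binary.PropositionalEquality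
  using (_≡_; _≢_; refl; sym; trans; cong; cong₂; subst; module ≡-Reasoning)

private variable
  k l m n : ℕ
  A : Set
  x : Fin n

dist-refl : (u : Vec Bool n) → dist u u ≡ 0
dist-refl []          = refl
dist-refl (true ∷ u)  = dist-refl u
dist-refl (false ∷ u) = dist-refl u

dist-sym : (u v : Vec Bool n) → dist u v ≡ dist v u
dist-sym []          []          = refl
dist-sym (true ∷ u)  (true ∷ v)  = dist-sym u v
dist-sym (true ∷ u)  (false ∷ v) = cong suc (dist-sym u v)
dist-sym (false ∷ u) (true ∷ v)  = cong suc (dist-sym u v)
dist-sym (false ∷ u) (false ∷ v) = dist-sym u v

dist-++ : (u u′ : Vec Bool k) (v v′ : Vec Bool l) → dist (u ++ v) (u′ ++ v′) ≡ dist u u′ + dist v v′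
dist-++ []          []           v v′ = refl
dist-++ (true ∷ u)  (true ∷ u′)  v v′ = dist-++ u u′ v v′
dist-++ (true ∷ u)  (false ∷ u′) v v′ = cong suc (dist-++ u u′ v v′)
dist-++ (false ∷ u) (true ∷ u′)  v v′ = cong suc (dist-++ u u′ v v′)
dist-++ (false ∷ u) (false ∷ u′) v v′ = dist-++ u u′ v v′

pad : m ≤ n → Vec Bool m → Vec Bool n
pad z≤n       []       = replicate _ false
pad (s≤s m≤n) (b ∷ u)  = b ∷ pad m≤n u

dist-pad : (m≤n : m ≤ n) (u v : Vec Bool m) → dist (pad m≤n u) (pad m≤n v) ≡ dist u v
dist-pad {n = n} z≤n [] [] = dist-refl (replicate n false)
dist-pad (s≤s m≤n) (true ∷ u)  (true ∷ v)  = dist-pad m≤n u v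
dist-pad (s≤s m≤n) (true ∷ u)  (false ∷ v) = cong suc (dist-pad m≤n u v)
dist-pad (s≤s m≤n) (false ∷ u) (true ∷ v)  = cong suc (dist-pad m≤n u v)
dist-pad (s≤s m≤n) (false ∷ u) (false ∷ v) = dist-pad m≤n u v

infixl 6 _⊕_
_⊕_ : Subset n → Subset n → Subset n
p ⊕ q = zipWith _xor_ p q

dist≡∣⊕∣ : (u v : Vec Bool n) → dist u v ≡ ∣ u ⊕ v ∣
dist≡∣⊕∣ []          []          = refl
dist≡∣⊕∣ (true ∷ u)  (true ∷ v)  = dist≡∣⊕∣ u v
dist≡∣⊕∣ (true ∷ u)  (false ∷ v) = cong suc (dist≡∣⊕∣ u v)
dist≡∣⊕∣ (false ∷ u) (true ∷ v)  = cong suc (dist≡∣⊕∣ u v)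
dist≡∣⊕∣ (false ∷ u) (false ∷ v) = dist≡∣⊕∣ u v

∣p⊕q∣+2∣p∩q∣≡∣p∣+∣q∣ : (p q : Subset n) → ∣ p ⊕ q ∣ + 2 * ∣ p ∩ q ∣ ≡ ∣ p ∣ + ∣ q ∣
∣p⊕q∣+2∣p∩q∣≡∣p∣+∣q∣ []          []          = refl
∣p⊕q∣+2∣p∩q∣≡∣p∣+∣q∣ (true ∷ p)  (true ∷ q)  = begin
  ∣ p ⊕ q ∣ + 2 * suc ∣ p ∩ q ∣          ≡⟨ cong (∣ p ⊕ q ∣ +_) (*-suc 2 ∣ p ∩ q ∣) ⟩
  ∣ p ⊕ q ∣ + (2 + 2 * ∣ p ∩ q ∣)        ≡⟨ +-suc _ _ ⟩
  suc (∣ p ⊕ q ∣ + suc (2 * ∣ p ∩ q ∣))  ≡⟨ cong suc (+-suc _ _) ⟩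
  2 + (∣ p ⊕ q ∣ + 2 * ∣ p ∩ q ∣)        ≡⟨ cong (2 +_) (∣p⊕q∣+2∣p∩q∣≡∣p∣+∣q∣ p q) ⟩
  2 + (∣ p ∣ + ∣ q ∣)                    ≡⟨ cong suc (+-suc _ _) ⟨
  suc ∣ p ∣ + suc ∣ q ∣                  ∎
  where open ≡-Reasoning
∣p⊕q∣+2∣p∩q∣≡∣p∣+∣q∣ (true ∷ p)  (false ∷ q) = cong suc (∣p⊕q∣+2∣p∩q∣≡∣p∣+∣q∣ p q)
∣p⊕q∣+2∣p∩q∣≡∣p∣+∣q∣ (false ∷ p) (true ∷ q)  =
  trans (cong suc (∣p⊕q∣+2∣p∩q∣≡∣p∣+∣q∣ p q)) (sym (+-suc _ _))
∣p⊕q∣+2∣p∩q∣≡∣p∣+∣q∣ (false ∷ p) (false ∷ q) = ∣p⊕q∣+2∣p∩q∣≡∣p∣+∣q∣ p q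

xor-cancelʳ : ∀ u v w → (u xor w) xor (v xor w) ≡ u xor v
xor-cancelʳ false false w     = xor-same w
xor-cancelʳ true  true  w     = xor-same (not w)
xor-cancelʳ false true  false = refl
xor-cancelʳ false true  true  = refl
xor-cancelʳ true  false false = refl
xor-cancelʳ true  false true  = refl

⊕-cancelʳ : (p q r : Subset n) → (p ⊕ r) ⊕ (q ⊕ r) ≡ p ⊕ q
⊕-cancelʳ []      []      []      = refl
⊕-cancelʳ (u ∷ p) (v ∷ q) (w ∷ r) = cong₂ _∷_ (xor-cancelʳ u v w) (⊕-cancelʳ p q r)

x∈p⊕q⇒xor : {p q : Subset n} → x ∈ p ⊕ q → lookup p x xor lookup q x ≡ true
x∈p⊕q⇒xor {x = x} {p} {q} x∈p⊕q = trans (sym (lookup-zipWith _xor_ x p q)) ([]=⇒lookup x∈p⊕q)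

xor⇒x∈p⊕q : {p q : Subset n} → lookup p x xor lookup q x ≡ true → x ∈ p ⊕ q
xor⇒x∈p⊕q {x = x} {p} {q} e = lookup⇒[]= x (p ⊕ q) (trans (lookup-zipWith _xor_ x p q) e)

⊕-triangle : {u v w : Subset n} → x ∈ u ⊕ w → x ∈ v ⊕ w → x ∉ v ⊕ u
⊕-triangle {x = x} {u} {v} {w} x∈u⊕w x∈v⊕w x∈v⊕u =
  bits (lookup u x) (lookup v x) (lookup w x) (x∈p⊕q⇒xor x∈u⊕w) (x∈p⊕q⇒xor x∈v⊕w) (x∈p⊕q⇒xor x∈v⊕u)
  where
  bits : ∀ u v w → u xor w ≡ true → v xor w ≡ true → v xor u ≢ true
  bits false false _     _  _  ()
  bits true  true  _     _  _  ()
  bits false true  false () _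
  bits false true  true  _  ()
  bits true  false false _  ()
  bits true  false true  () _

⊕-trans : {p q r : Subset n} → x ∈ r ⊕ q → x ∉ p ⊕ r → x ∈ p ⊕ q
⊕-trans {x = x} {p} {q} {r} x∈r⊕q x∉p⊕r =
  xor⇒x∈p⊕q (bits (lookup p x) (lookup r x) (lookup q x) (x∈p⊕q⇒xor x∈r⊕q) (x∉p⊕r ∘ xor⇒x∈p⊕q))
  where
  bits : ∀ u w v → w xor v ≡ true → u xor w ≢ true → u xor v ≡ true
  bits false false _ e _  = e
  bits true  true  _ e _  = e
  bits false true  _ _ ne = contradiction refl ne
  bits true  false _ _ ne = contradiction refl ne

⊆∧∣∣≤⇒≡ : {p q : Subset n} → p ⊆ q → ∣ q ∣ ≤ ∣ p ∣ → p ≡ q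
⊆∧∣∣≤⇒≡ {p = p} {q} p⊆q ∣q∣≤∣p∣ = ⊆-antisym p⊆q q⊆p
  where
  q⊆p : q ⊆ p
  q⊆p {x} x∈q with x ∈? p
  ... | yes x∈p = x∈p
  ... | no  x∉p = contradiction ∣q∣≤∣p∣ (<⇒≱ (p⊂q⇒∣p∣<∣q∣ (p⊆q , x , x∈q , x∉p)))

x∈p─q⇒x∉q : (p q : Subset n) → x ∈ p ─ q → x ∉ q
x∈p─q⇒x∉q (_ ∷ p)    (false ∷ q) (Vec.there x∈p─q) (Vec.there x∈q) = x∈p─q⇒x∉q p q x∈p─q x∈q
x∈p─q⇒x∉q (_ ∷ p)    (true  ∷ q) (Vec.there x∈p─q) (Vec.there x∈q) = x∈p─q⇒x∉q p q x∈p─q x∈q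
x∈p─q⇒x∉q (true ∷ p) (false ∷ q) Vec.here ()

Empty[Z∩X─G]⇒Z∩X⊆G : {Z X G : Subset n} → Empty (Z ∩ (X ─ G)) → Z ∩ X ⊆ G
Empty[Z∩X─G]⇒Z∩X⊆G {Z = Z} {X} {G} empty {x} x∈Z∩X with x ∈? G
... | yes x∈G = x∈G
... | no  x∉G = let x∈Z , x∈X = x∈p∩q⁻ Z X x∈Z∩X in
  contradiction (x , x∈p∩q⁺ (x∈Z , x∈p∧x∉q⇒x∈p─q x∈X x∉G)) empty

Any-map-All : {P Q R : A → Set} {xs : List A} → (∀ {x} → P x → Q x → R x) → All P xs → Any Q xs → Any R xs
Any-map-All f (p ∷ _)  (here q)  = here (f p q)
Any-map-All f (_ ∷ ps) (there i) = there (Any-map-All f ps i)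

AllPairs-resp-⊑ : {R : A → A → Set} {xs ys : List A} → xs ⊑ ys → AllPairs R ys → AllPairs R xs
AllPairs-resp-⊑ []         []       = []
AllPairs-resp-⊑ (y ∷ʳ τ)   (_ ∷ rs) = AllPairs-resp-⊑ τ rs
AllPairs-resp-⊑ (refl ∷ τ) (r ∷ rs) = All-resp-⊆ τ r ∷ AllPairs-resp-⊑ τ rs

AllPairs-map-All : {P : A → Set} {R S : A → A → Set} {xs : List A} →
                   (∀ {s t} → P s → P t → R s t → S s t) → All P xs → AllPairs R xs → AllPairs S xs
AllPairs-map-All f []       []       = []
AllPairs-map-All f (p ∷ ps) (r ∷ rs) = All.zipWith (λ (q , r′) → f p q r′) (ps , r) ∷ AllPairs-map-All f ps rs

-- Removing a member P t that Z meets shrinks Z without changing how it meets the other members.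
misses-some : (P : A → Subset n) {J : List A} → AllPairs (λ s t → Empty (P s ∩ P t)) J →
              (Z : Subset n) → ∣ Z ∣ < length J → Any (λ t → Empty (Z ∩ P t)) J
misses-some P {t ∷ J} (disjoint ∷ disjoints) Z ∣Z∣<∣J∣ with nonempty? (Z ∩ P t)
... | no  empty    = here empty
... | yes nonempty = there (Any-map-All shrink disjoint (misses-some P disjoints (Z ─ P t) smaller))
  where
  smaller : ∣ Z ─ P t ∣ < length J
  smaller = <-≤-trans (p∩q≢∅⇒∣p─q∣<∣p∣ Z (P t) nonempty) (≤-pred ∣Z∣<∣J∣)
  shrink : ∀ {s} → Empty (P t ∩ P s) → Empty ((Z ─ P t) ∩ P s) → Empty (Z ∩ P s)
  shrink {s} Pt∩Ps-empty Z′∩Ps-empty (x , x∈Z∩Ps) =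
    let x∈Z , x∈Ps = x∈p∩q⁻ Z (P s) x∈Z∩Ps
        x∉Pt = λ x∈Pt → Pt∩Ps-empty (x , x∈p∩q⁺ (x∈Pt , x∈Ps))
    in Z′∩Ps-empty (x , x∈p∩q⁺ (x∈p∧x∉q⇒x∈p─q x∈Z x∉Pt , x∈Ps))

length-filter-true+false : (φ : A → Bool) (L : List A) →
  length (filter (λ t → φ t Bool.≟ true) L) + length (filter (λ t → φ t Bool.≟ false) L) ≡ length L
length-filter-true+false φ []      = refl
length-filter-true+false φ (t ∷ L) with φ t
... | true  = cong suc (length-filter-true+false φ L)
... | false = trans (+-suc _ _) (cong suc (length-filter-true+false φ L))

majority : (φ : A → Bool) (L : List A) →
           ∃₂ λ g J → J ⊑ L × length L ≤ 2 * length J × All (λ t → φ t ≡ g) J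
majority {A = A} φ L = larger (≤-total T F)
  where
  sieve : Bool → List A
  sieve g = filter (λ t → φ t Bool.≟ g) L
  T F : ℕ
  T = length (sieve true)
  F = length (sieve false)
  doubled : ∀ {y} → T + F ≤ y + y → length L ≤ 2 * y
  doubled {y} T+F≤y+y = begin
    length L ≡⟨ length-filter-true+false φ L ⟨
    T + F    ≤⟨ T+F≤y+y ⟩
    y + y    ≡⟨ cong (y +_) (+-identityʳ y) ⟨
    2 * y    ∎
    where open ≤-Reasoning
  larger : T ≤ F ⊎ F ≤ T → ∃₂ λ g J → J ⊑ L × length L ≤ 2 * length J × All (λ t → φ t ≡ g) J
  larger (inj₁ T≤F) = false , sieve false , filter-⊆ _ L , doubled {F} (+-monoˡ-≤ F T≤F) , All.all-filter _ L
  larger (inj₂ F≤T) = true  , sieve true  , filter-⊆ _ L , doubled {T} (+-monoʳ-≤ T F≤T) , All.all-filter _ L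

∩-∷ : (r : Bool) (R : Subset n) (v : Subset (suc n)) → (r ∷ R) ∩ v ≡ (r ∧ head v) ∷ (R ∩ tail v)
∩-∷ r R (b ∷ v) = refl

-- Pigeonhole over the 2 ^ ∣ R ∣ possible traces R ∩ X t, one coordinate of R at a time.
patterns : (R : Subset n) (X : A → Subset n) (L : List A) →
           ∃₂ λ G J → J ⊑ L × length L ≤ 2 ^ ∣ R ∣ * length J × All (λ t → R ∩ X t ≡ G) J
patterns [] X L = [] , L , ⊆-refl , ≤-reflexive (sym (*-identityˡ _)) , All.universal (λ t → []∩ (X t)) L
  where
  []∩ : (v : Subset 0) → [] ∩ v ≡ []
  []∩ [] = refl
patterns (r ∷ R) X L with patterns R (tail ∘ X) L
... | G , J , J⊑L , bound , agree with r
...   | false =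
  false ∷ G , J , J⊑L , bound , All.map (λ {t} e → trans (∩-∷ false R (X t)) (cong (false ∷_) e)) agree
...   | true  with majority (head ∘ X) J
...     | g , J′ , J′⊑J , half , heads =
  g ∷ G , J′ , ⊆-trans J′⊑J J⊑L , bound′ ,
  All.zipWith (λ {t} (h , e) → trans (∩-∷ true R (X t)) (cong₂ _∷_ h e)) (heads , All-resp-⊆ J′⊑J agree)
  where
  bound′ : length L ≤ 2 ^ suc ∣ R ∣ * length J′
  bound′ = begin
    length L                     ≤⟨ bound ⟩
    2 ^ ∣ R ∣ * length J         ≤⟨ *-monoʳ-≤ (2 ^ ∣ R ∣) half ⟩
    2 ^ ∣ R ∣ * (2 * length J′)  ≡⟨ *-assoc (2 ^ ∣ R ∣) 2 _ ⟨
    2 ^ ∣ R ∣ * 2 * length J′    ≡⟨ cong (_* length J′) (*-comm (2 ^ ∣ R ∣) 2) ⟩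
    2 ^ suc ∣ R ∣ * length J′    ∎
    where open ≤-Reasoning

Equidistant : (X : A → Subset n) (a b : ℕ) → List A → Set
Equidistant X a b L = All (λ t → ∣ X t ∣ ≡ a) L × AllPairs (λ s t → ∣ X s ⊕ X t ∣ ≡ b) L

record Sunflower (X : A → Subset n) (a b : ℕ) (t₀ : A) (L : List A) (M : ℕ) : Set where
  field
    kernel      : Subset n
    members     : List A
    members⊑L   : members ⊑ L
    many        : M ≤ length members
    ∩≡kernel    : AllPairs (λ s t → X s ∩ X t ≡ kernel) (t₀ ∷ members)
    kernel-size : b + 2 * ∣ kernel ∣ ≡ a + a
    kernel⊆t₀   : kernel ⊆ X t₀

equidistant-∣∩∣ : (p q : Subset n) {a b : ℕ} → ∣ p ∣ ≡ a → ∣ q ∣ ≡ a → ∣ p ⊕ q ∣ ≡ b →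
                  b + 2 * ∣ p ∩ q ∣ ≡ a + a
equidistant-∣∩∣ p q ∣p∣≡a ∣q∣≡a ∣p⊕q∣≡b =
  trans (cong (_+ _) (sym ∣p⊕q∣≡b)) (trans (∣p⊕q∣+2∣p∩q∣≡∣p∣+∣q∣ p q) (cong₂ _+_ ∣p∣≡a ∣q∣≡a))

+2*-injective : ∀ b {c} x y → b + 2 * x ≡ c → b + 2 * y ≡ c → x ≡ y
+2*-injective b x y e e′ = *-cancelˡ-≡ x y 2 (+-cancelˡ-≡ b _ _ (trans e (sym e′)))

common-intersection : {X₀ Xs Xt G : Subset n} {a b : ℕ} → ∣ X₀ ∣ ≡ a → ∣ Xs ∣ ≡ a → ∣ Xt ∣ ≡ a →
                      ∣ X₀ ⊕ Xs ∣ ≡ b → ∣ Xs ⊕ Xt ∣ ≡ b → X₀ ∩ Xs ≡ G → X₀ ∩ Xt ≡ G → Xs ∩ Xt ≡ G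
common-intersection {X₀ = X₀} {Xs} {Xt} {G} {b = b} ∣X₀∣ ∣Xs∣ ∣Xt∣ d₀s dst refl e₀t =
  sym (⊆∧∣∣≤⇒≡ G⊆Xs∩Xt (≤-reflexive same-size))
  where
  G⊆Xs∩Xt : G ⊆ Xs ∩ Xt
  G⊆Xs∩Xt x∈G = x∈p∩q⁺ (p∩q⊆q X₀ Xs x∈G , p∩q⊆q X₀ Xt (subst (_ ∈_) (sym e₀t) x∈G))
  same-size : ∣ Xs ∩ Xt ∣ ≡ ∣ G ∣
  same-size = +2*-injective b _ _ (equidistant-∣∩∣ Xs Xt ∣Xs∣ ∣Xt∣ dst) (equidistant-∣∩∣ X₀ Xs ∣X₀∣ ∣Xs∣ d₀s)

sunflower : {X : A → Subset n} {a b M : ℕ} {t₀ : A} {L : List A} →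
            Equidistant X a b (t₀ ∷ L) → 2 ^ a * suc M ≤ length L → Sunflower X a b t₀ L (suc M)
sunflower {A = A} {X = X} {a} {b} {M} {t₀} {L} (∣t₀∣ ∷ ∣L∣ , d₀ ∷ dL) big with patterns (X t₀) X L
... | G , J , J⊑L , bound , agree = record
  { kernel      = G
  ; members     = J
  ; members⊑L   = J⊑L
  ; many        = many
  ; ∩≡kernel    = agree ∷ AllPairs-map-All intersect facts (AllPairs-resp-⊑ J⊑L dL)
  ; kernel-size = proj₁ (from-first-member many facts)
  ; kernel⊆t₀   = proj₂ (from-first-member many facts)
  }
  where
  Fact : A → Set
  Fact t = ∣ X t ∣ ≡ a × ∣ X t₀ ⊕ X t ∣ ≡ b × X t₀ ∩ X t ≡ G
  facts : All Fact J
  facts = All.zipWith (λ ((∣t∣ , d₀t) , e) → ∣t∣ , d₀t , e) (All-resp-⊆ J⊑L (All.zip (∣L∣ , d₀)) , agree)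
  intersect : ∀ {s t} → Fact s → Fact t → ∣ X s ⊕ X t ∣ ≡ b → X s ∩ X t ≡ G
  intersect (∣s∣ , d₀s , e₀s) (∣t∣ , _ , e₀t) dst = common-intersection ∣t₀∣ ∣s∣ ∣t∣ d₀s dst e₀s e₀t
  many : suc M ≤ length J
  many = *-cancelˡ-≤ (2 ^ a) {{m^n≢0 2 a}}
           (≤-trans big (subst (λ e → length L ≤ 2 ^ e * length J) ∣t₀∣ bound))
  from-first-member : ∀ {J} → suc M ≤ length J → All Fact J → b + 2 * ∣ G ∣ ≡ a + a × G ⊆ X t₀
  from-first-member {t ∷ _} _ ((∣t∣ , d₀t , refl) ∷ _) =
    equidistant-∣∩∣ (X t₀) (X t) ∣t₀∣ ∣t∣ d₀t , p∩q⊆p (X t₀) (X t)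

module _ {X : A → Subset n} {a b t₀ L M} (S : Sunflower X a b t₀ L M) where
  open Sunflower S

  kernel⊆members : All (λ t → kernel ⊆ X t) members
  kernel⊆members = All.map (λ {t} e {x} → subst (_⊆ X t) e (p∩q⊆q (X t₀) (X t))) (AllPairs.head ∩≡kernel)

  petals-disjoint : AllPairs (λ s t → Empty ((X s ─ kernel) ∩ (X t ─ kernel))) members
  petals-disjoint = AllPairs.map disjoint (AllPairs.tail ∩≡kernel)
    where
    disjoint : ∀ {s t} → X s ∩ X t ≡ kernel → Empty ((X s ─ kernel) ∩ (X t ─ kernel))
    disjoint {s} {t} e (x , x∈) =
      let x∈s─G , x∈t─G = x∈p∩q⁻ (X s ─ kernel) (X t ─ kernel) x∈
      in x∈p─q⇒x∉q (X s) kernel x∈s─G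
           (subst (x ∈_) e (x∈p∩q⁺ (p─q⊆p (X s) kernel x∈s─G , p─q⊆p (X t) kernel x∈t─G)))

  meets-within-kernel : (Z : Subset n) → ∣ Z ∣ < length members → Any (λ t → Z ∩ X t ⊆ kernel) members
  meets-within-kernel Z small =
    Any.map Empty[Z∩X─G]⇒Z∩X⊆G (misses-some (λ t → X t ─ kernel) petals-disjoint Z small)

  meets-exactly-kernel : {Z : Subset n} → kernel ⊆ Z → ∣ Z ∣ < length members →
                         Any (λ t → Z ∩ X t ≡ kernel) members
  meets-exactly-kernel {Z} G⊆Z small = Any-map-All exact kernel⊆members (meets-within-kernel Z small)
    where
    exact : ∀ {t} → kernel ⊆ X t → Z ∩ X t ⊆ kernel → Z ∩ X t ≡ kernel
    exact G⊆t Z∩t⊆G = ⊆-antisym Z∩t⊆G (λ x∈G → x∈p∩q⁺ (G⊆Z x∈G , G⊆t x∈G))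

  equidistant⇒kernel⊆ : Equidistant X a b (t₀ ∷ L) → {Z : Subset n} → ∣ Z ∣ ≡ a →
                        All (λ t → ∣ Z ⊕ X t ∣ ≡ b) L → a < M → kernel ⊆ Z
  equidistant⇒kernel⊆ (_ ∷ ∣L∣ , _) {Z} ∣Z∣ dZ a<M =
    let (∣t∣ , dZt) , Z∩t⊆G = All.lookupAny (All-resp-⊆ members⊑L (All.zip (∣L∣ , dZ))) chosen
        same-size = +2*-injective b _ _ kernel-size (equidistant-∣∩∣ Z _ ∣Z∣ ∣t∣ dZt)
    in subst (_⊆ Z) (⊆∧∣∣≤⇒≡ Z∩t⊆G (≤-reflexive same-size)) (p∩q⊆p Z _)
    where
    chosen : Any (λ t → Z ∩ X t ⊆ kernel) members
    chosen = meets-within-kernel Z (<-≤-trans (subst (_< M) (sym ∣Z∣) a<M) many)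

MapsDistance : (Vec Bool n → Vec Bool m) → ℕ → ℕ → Set
MapsDistance E d e = ∀ {u v} → dist u v ≡ d → dist (E u) (E v) ≡ e

isCode⇒mapsDistance : {Dom : ℕ → Set} (f : PartialFun Dom) (E : Vec Bool n → Vec Bool m) → IsCode f E →
                      ∀ {d} (h : Dom d) → MapsDistance E d (f d h)
isCode⇒mapsDistance f E code h {u} {v} refl = code u v h

isCode-∘ : {Dom : ℕ → Set} {f : PartialFun Dom} {E : Vec Bool n → Vec Bool m} → IsCode f E →
           (ι : Vec Bool k → Vec Bool n) → (∀ u v → dist (ι u) (ι v) ≡ dist u v) → IsCode f (E ∘ ι)
isCode-∘ code ι isometry u v h with dist (ι u) (ι v) | isometry u v | code (ι u) (ι v)
... | _ | refl | code-at = code-at h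

codes-in-every-dimension : {Dom : ℕ → Set} {f : PartialFun Dom} → Realizable f →
                           ∀ k → ∃[ m ] Σ (Vec Bool k → Vec Bool m) (IsCode f)
codes-in-every-dimension {f = f} (m , realizable) k with realizable k
... | n , k≤n , E , code = m n , E ∘ pad k≤n , isCode-∘ {f = f} {E = E} code (pad k≤n) (dist-pad k≤n)

Star : Vec Bool n → List (Vec Bool n) → Set
Star o L = All (λ p → dist p o ≡ 2) L × AllPairs (λ p q → dist p q ≡ 4) L

record Configuration (n K : ℕ) : Set where
  field
    O V Y   : Vec Bool n
    Ps Qs   : List (Vec Bool n)
    many-Ps : K ≤ length Ps
    many-Qs : K ≤ length Qs
    star-O  : Star O (V ∷ Ps)
    star-V  : Star V (O ∷ Qs)
    Y-O     : dist Y O ≡ 2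
    Y-V     : dist Y V ≡ 2
    Y-Ps    : All (λ p → dist Y p ≡ 4) Ps
    Y-Qs    : All (λ q → dist Y q ≡ 4) Qs
    Ps-Qs   : All (λ p → All (λ q → dist p q ≡ 6) Qs) Ps

spokes : (K : ℕ) → List (Vec Bool (K * 2))
spokes zero    = []
spokes (suc K) = (true ∷ true ∷ replicate (K * 2) false) ∷ map (λ s → false ∷ false ∷ s) (spokes K)

length-spokes : ∀ K → length (spokes K) ≡ K
length-spokes zero    = refl
length-spokes (suc K) = cong suc (trans (length-map _ (spokes K)) (length-spokes K))

spokes-weight : ∀ K → All (λ s → dist s (replicate (K * 2) false) ≡ 2) (spokes K)
spokes-weight zero    = []
spokes-weight (suc K) = cong (2 +_) (dist-refl (replicate (K * 2) false)) ∷ All.map⁺ (spokes-weight K)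

spokes-weight′ : ∀ K → All (λ s → dist (replicate (K * 2) false) s ≡ 2) (spokes K)
spokes-weight′ K = All.map (λ {s} d → trans (dist-sym _ s) d) (spokes-weight K)

spokes-apart : ∀ K → AllPairs (λ s t → dist s t ≡ 4) (spokes K)
spokes-apart zero    = []
spokes-apart (suc K) = All.map⁺ (All.map (cong (2 +_)) (spokes-weight′ K)) ∷ AllPairs.map⁺ (spokes-apart K)

dist-++-++ : ∀ {i j h} (g g′ : Vec Bool k) (s s′ : Vec Bool l) (t t′ : Vec Bool m) →
             dist g g′ ≡ i → dist s s′ ≡ j → dist t t′ ≡ h → dist (g ++ s ++ t) (g′ ++ s′ ++ t′) ≡ i + (j + h)
dist-++-++ g g′ s s′ t t′ refl refl refl =
  trans (dist-++ g g′ (s ++ t) (s′ ++ t′)) (cong (dist g g′ +_) (dist-++ s s′ t t′))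

configuration : ∀ K (o v y : Vec Bool k) → dist v o ≡ 2 → dist y o ≡ 2 → dist y v ≡ 2 →
                Configuration (k + (K * 2 + K * 2)) K
configuration {k} K o v y dvo dyo dyv = record
  { O       = o ++ 0ᴷ ++ 0ᴷ
  ; V       = v ++ 0ᴷ ++ 0ᴷ
  ; Y       = y ++ 0ᴷ ++ 0ᴷ
  ; Ps      = map (λ s → o ++ s ++ 0ᴷ) (spokes K)
  ; Qs      = map (λ s → v ++ 0ᴷ ++ s) (spokes K)
  ; many-Ps = many
  ; many-Qs = many
  ; star-O  = ( dist-++-++ v o 0ᴷ 0ᴷ 0ᴷ 0ᴷ dvo z z
              ∷ All.map⁺ (All.map (λ {s} w → dist-++-++ o o s 0ᴷ 0ᴷ 0ᴷ (dist-refl o) w z) weight))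
            , ( All.map⁺ (All.map (λ {s} w → dist-++-++ v o 0ᴷ s 0ᴷ 0ᴷ dvo w z) weight′)
              ∷ AllPairs.map⁺ (AllPairs.map (λ {s} {s′} d → dist-++-++ o o s s′ 0ᴷ 0ᴷ (dist-refl o) d z)
                                            (spokes-apart K)))
  ; star-V  = ( dist-++-++ o v 0ᴷ 0ᴷ 0ᴷ 0ᴷ dov z z
              ∷ All.map⁺ (All.map (λ {s} w → dist-++-++ v v 0ᴷ 0ᴷ s 0ᴷ (dist-refl v) z w) weight))
            , ( All.map⁺ (All.map (λ {s} w → dist-++-++ o v 0ᴷ 0ᴷ 0ᴷ s dov z w) weight′)
              ∷ AllPairs.map⁺ (AllPairs.map (λ {s} {s′} d → dist-++-++ v v 0ᴷ 0ᴷ s s′ (dist-refl v) z d)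
                                            (spokes-apart K)))
  ; Y-O     = dist-++-++ y o 0ᴷ 0ᴷ 0ᴷ 0ᴷ dyo z z
  ; Y-V     = dist-++-++ y v 0ᴷ 0ᴷ 0ᴷ 0ᴷ dyv z z
  ; Y-Ps    = All.map⁺ (All.map (λ {s} w → dist-++-++ y o 0ᴷ s 0ᴷ 0ᴷ dyo w z) weight′)
  ; Y-Qs    = All.map⁺ (All.map (λ {s} w → dist-++-++ y v 0ᴷ 0ᴷ 0ᴷ s dyv z w) weight′)
  ; Ps-Qs   = All.map⁺ (All.map (λ {s} w → All.map⁺ (All.map (λ {s′} w′ → dist-++-++ o v s 0ᴷ 0ᴷ s′ dov w w′)
                                                             weight′))
                                weight)
  }
  where
  0ᴷ : Vec Bool (K * 2)
  0ᴷ = replicate (K * 2) false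
  z : dist 0ᴷ 0ᴷ ≡ 0
  z = dist-refl 0ᴷ
  dov : dist o v ≡ 2
  dov = trans (dist-sym o v) dvo
  weight : All (λ s → dist s 0ᴷ ≡ 2) (spokes K)
  weight = spokes-weight K
  weight′ : All (λ s → dist 0ᴷ s ≡ 2) (spokes K)
  weight′ = spokes-weight′ K
  many : {f : Vec Bool (K * 2) → Vec Bool (k + (K * 2 + K * 2))} → K ≤ length (map f (spokes K))
  many = ≤-reflexive (sym (trans (length-map _ (spokes K)) (length-spokes K)))

midpoint : ∀ a b c g → c + 2 * g ≡ b + a → b + 2 * g ≡ a + a → 2 * b ≡ a + c
midpoint a b c g e₁ e₂ = +-cancelʳ-≡ (2 * g) (2 * b) (a + c) (begin
  2 * b + 2 * g     ≡⟨ cong (λ e → b + e + 2 * g) (+-identityʳ b) ⟩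
  b + b + 2 * g     ≡⟨ +-assoc b b (2 * g) ⟩
  b + (b + 2 * g)   ≡⟨ cong (b +_) e₂ ⟩
  b + (a + a)       ≡⟨ +-assoc b a a ⟨
  b + a + a         ≡⟨ +-comm (b + a) a ⟩
  a + (b + a)       ≡⟨ cong (a +_) e₁ ⟨
  a + (c + 2 * g)   ≡⟨ +-assoc a c (2 * g) ⟨
  a + c + 2 * g     ∎)
  where open ≡-Reasoning

module Rigidity {a b c : ℕ} (E : Vec Bool n → Subset m)
                (E₂ : MapsDistance E 2 a) (E₄ : MapsDistance E 4 b) (E₆ : MapsDistance E 6 c)
                (cfg : Configuration n (2 ^ a * suc (a + b))) where

  open Configuration cfg

  Δ : Vec Bool n → Vec Bool n → Subset m
  Δ o p = E p ⊕ E o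

  ∣Δ∣ : ∀ o p → ∣ Δ o p ∣ ≡ dist (E p) (E o)
  ∣Δ∣ o p = sym (dist≡∣⊕∣ (E p) (E o))

  ∣Δ⊕Δ∣ : ∀ o p q → ∣ Δ o p ⊕ Δ o q ∣ ≡ dist (E p) (E q)
  ∣Δ⊕Δ∣ o p q = trans (cong ∣_∣ (⊕-cancelʳ (E p) (E q) (E o))) (sym (dist≡∣⊕∣ (E p) (E q)))

  star⇒equidistant : ∀ {o L} → Star o L → Equidistant (Δ o) a b L
  star⇒equidistant {o} (near , apart) =
    All.map (λ {p} d → trans (∣Δ∣ o p) (E₂ d)) near ,
    AllPairs.map (λ {p} {q} d → trans (∣Δ⊕Δ∣ o p q) (E₄ d)) apart

  -- Larger than a and b, the sizes of the sets that must miss a petal.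
  M : ℕ
  M = suc (a + b)

  kernel⊆ΔY : ∀ {o v L} (S : Sunflower (Δ o) a b v L M) → Equidistant (Δ o) a b (v ∷ L) →
              dist Y o ≡ 2 → All (λ p → dist Y p ≡ 4) L → Sunflower.kernel S ⊆ Δ o Y
  kernel⊆ΔY {o} S equidistant dYo dYL =
    equidistant⇒kernel⊆ S equidistant (trans (∣Δ∣ o Y) (E₂ dYo))
      (All.map (λ {p} d → trans (∣Δ⊕Δ∣ o Y p) (E₄ d)) dYL) (s≤s (m≤m+n a b))

  S₀ : Sunflower (Δ O) a b V Ps M
  S₀ = sunflower (star⇒equidistant star-O) many-Ps

  Sᵥ : Sunflower (Δ V) a b O Qs M
  Sᵥ = sunflower (star⇒equidistant star-V) many-Qs

  module S₀ = Sunflower S₀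
  module Sᵥ = Sunflower Sᵥ

  -- On a coordinate of both kernels, E O, E V and E Y would be pairwise different bits.
  kernels-disjoint : Empty (S₀.kernel ∩ Sᵥ.kernel)
  kernels-disjoint (x , x∈G₀∩Gᵥ) =
    let x∈G₀ , x∈Gᵥ = x∈p∩q⁻ S₀.kernel Sᵥ.kernel x∈G₀∩Gᵥ
    in ⊕-triangle (S₀.kernel⊆t₀ x∈G₀) (kernel⊆ΔY S₀ (star⇒equidistant star-O) Y-O Y-Ps x∈G₀)
                  (kernel⊆ΔY Sᵥ (star⇒equidistant star-V) Y-V Y-Qs x∈Gᵥ)

  2b≡a+c-via-pair : ∀ {p r} → dist p V ≡ 4 → ∣ Δ V r ∣ ≡ a → dist p r ≡ 6 → Δ V p ∩ Δ V r ≡ Sᵥ.kernel →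
                    2 * b ≡ a + c
  2b≡a+c-via-pair {p} {r} dpV ∣Δr∣ dpr Δp∩Δr≡Gᵥ = midpoint a b c ∣ Sᵥ.kernel ∣ count Sᵥ.kernel-size
    where
    open ≡-Reasoning
    count : c + 2 * ∣ Sᵥ.kernel ∣ ≡ b + a
    count = begin
      c + 2 * ∣ Sᵥ.kernel ∣
        ≡⟨ cong₂ (λ d G → d + 2 * ∣ G ∣) (trans (∣Δ⊕Δ∣ V p r) (E₆ dpr)) Δp∩Δr≡Gᵥ ⟨
      ∣ Δ V p ⊕ Δ V r ∣ + 2 * ∣ Δ V p ∩ Δ V r ∣
        ≡⟨ ∣p⊕q∣+2∣p∩q∣≡∣p∣+∣q∣ (Δ V p) (Δ V r) ⟩
      ∣ Δ V p ∣ + ∣ Δ V r ∣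
        ≡⟨ cong₂ _+_ (trans (∣Δ∣ V p) (E₄ dpV)) ∣Δr∣ ⟩
      b + a
        ∎

  kernelᵥ⊆Δ : ∀ {p} → Sᵥ.kernel ∩ Δ O p ⊆ S₀.kernel → Sᵥ.kernel ⊆ Δ V p
  kernelᵥ⊆Δ Gᵥ∩Δp⊆G₀ x∈Gᵥ = ⊕-trans (Sᵥ.kernel⊆t₀ x∈Gᵥ)
    (λ x∈Δp → kernels-disjoint (_ , x∈p∩q⁺ (Gᵥ∩Δp⊆G₀ (x∈p∩q⁺ (x∈Gᵥ , x∈Δp)) , x∈Gᵥ)))

  2b≡a+c-via-spoke : ∀ {p} → dist V p ≡ 4 → All (λ q → dist p q ≡ 6) Qs → Sᵥ.kernel ∩ Δ O p ⊆ S₀.kernel →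
                     2 * b ≡ a + c
  2b≡a+c-via-spoke {p} dVp dpQs Gᵥ∩Δp⊆G₀ =
    let (∣Δr∣ , dpr) , Δp∩Δr≡Gᵥ =
          All.lookupAny (All-resp-⊆ Sᵥ.members⊑L (All.zip (∣Δq∣ , dpQs)))
                        (meets-exactly-kernel Sᵥ (kernelᵥ⊆Δ Gᵥ∩Δp⊆G₀) (<-≤-trans ∣Δp∣<M Sᵥ.many))
    in 2b≡a+c-via-pair dpV ∣Δr∣ dpr Δp∩Δr≡Gᵥ
    where
    dpV : dist p V ≡ 4
    dpV = trans (dist-sym p V) dVp
    ∣Δp∣<M : ∣ Δ V p ∣ < M
    ∣Δp∣<M = subst (_< M) (sym (trans (∣Δ∣ V p) (E₄ dpV))) (s≤s (m≤n+m b a))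
    ∣Δq∣ : All (λ q → ∣ Δ V q ∣ ≡ a) Qs
    ∣Δq∣ = All.tail (proj₁ (star⇒equidistant star-V))

  2b≡a+c : 2 * b ≡ a + c
  2b≡a+c =
    let (dVp , dpQs) , Gᵥ∩Δp⊆G₀ =
          All.lookupAny (All-resp-⊆ S₀.members⊑L (All.zip (AllPairs.head (proj₂ star-O) , Ps-Qs)))
                        (meets-within-kernel S₀ Sᵥ.kernel (<-≤-trans ∣Gᵥ∣<M S₀.many))
    in 2b≡a+c-via-spoke dVp dpQs Gᵥ∩Δp⊆G₀
    where
    ∣Gᵥ∣<M : ∣ Sᵥ.kernel ∣ < M
    ∣Gᵥ∣<M = s≤s (≤-trans (p⊆q⇒∣p∣≤∣q∣ Sᵥ.kernel⊆t₀)
                          (≤-trans (≤-reflexive (All.head (proj₁ (star⇒equidistant star-V)))) (m≤m+n a b)))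

theorem1p9 : (f : PartialFun Dom246) → Realizable f →
    2 * f 4 (inj₂ (inj₁ refl)) ≡ f 2 (inj₁ refl) + f 6 (inj₂ (inj₂ refl))
theorem1p9 f realizable =
  let _ , E , code = codes-in-every-dimension {f = f} realizable (4 + (K * 2 + K * 2))
  in Rigidity.2b≡a+c E (isCode⇒mapsDistance f E code (inj₁ refl))
                       (isCode⇒mapsDistance f E code (inj₂ (inj₁ refl)))
                       (isCode⇒mapsDistance f E code (inj₂ (inj₂ refl)))
                       (configuration K o v y refl refl refl)
  where
  K : ℕ
  K = 2 ^ f 2 (inj₁ refl) * suc (f 2 (inj₁ refl) + f 4 (inj₂ (inj₁ refl)))
  o v y : Vec Bool 4
  o = false ∷ false ∷ false ∷ false ∷ []
  v = true  ∷ true  ∷ false ∷ false ∷ []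
  y = false ∷ true  ∷ true  ∷ false ∷ []
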